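{- For real $T\ge 2$ and positive integers $n$, let $\Phi(n)=\#\{u\in\{1,\dots,n\}:\gcd(u,n)\le T\}$. Then for all $X\ge 1$ and $T\ge2$, \[ \sum_{n\le X}\Bigl(1-\frac{\Phi(n)}{n}\Bigr)\ll \frac{X}{T}, \] with an absolute implied constant. -}

module Defs where

open import Data.Nat using (ℕ; zero; suc; _≤?_)
open import Data.Nat.GCD using (gcd)
open import Data.List using (List; map; filter; length; upTo; foldr)
open import Data.Integer using (+_)
open import Data.Rational using (ℚ; _/_; _+_; _-_; 0ℚ; 1ℚ)

Φ : ℕ → ℕ → ℕ
Φ T n = length (filter (λ u → gcd u n ≤? T) (map suc (upTo n)))

-- the summand 1 - Φ(n)/n, for n = suc k ≥ 1
term : ℕ → ℕ → ℚ
term T k = 1ℚ - ((+ Φ T (suc k)) / suc k)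

S : ℕ → ℕ → ℚ
S T X = foldr _+_ 0ℚ (map (term T) (upTo X))

{-# OPTIONS --safe #-}
module Submission where

-- 1 - Φ(n)/n is the proportion of u ∈ [1, n] with gcd(u, n) > T. Each such u is a multiple of
-- the divisor d = gcd(u, n) > T of n, and [1, n] contains n/d multiples of d, so
-- 1 - Φ(n)/n ≤ Σ_{d ∣ n, d > T} 1/d. Summing over n ≤ X and exchanging the sums, each d > T
-- divides at most X/d of the n, so the whole sum is at most X Σ_{d > T} 1/d² ≤ X/T, the last
-- step by telescoping 1/d² ≤ 1/(d - 1) - 1/d.

open import Defs
open import Data.Nat using (ℕ)
open import Data.Product using (∃)
open import Data.Integer using (+_)
open import Data.Rational using (_≤_; _*_; _/_)
open import Data.Nat using () renaming (_≤_ to _≤ℕ_; _*_ to _*ℕ_)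

open import Algebra.Bundles using (CommutativeMonoid; CommutativeSemigroup)
open import Algebra.Core using (Op₂)
open import Algebra.Structures using (IsCommutativeSemiring; IsCommutativeRing)
open import Data.Bool using (true; false; if_then_else_)
open import Data.Integer as ℤ using ()
import Data.Integer.Properties as ℤ
open import Data.List using (List; []; _∷_; _++_; [_]; map; filter; length; upTo; foldr)
open import Data.List.Properties using (upTo-∷ʳ; map-++; filter-++; length-++; length-map; length-upTo)
open import Data.List.Membership.Propositional using (_∈_)
open import Data.List.Membership.Propositional.Properties using (∈-upTo⁺)
open import Data.List.Relation.Unary.All as All using (All; []; _∷_)
open import Data.List.Relation.Unary.All.Properties using (applyUpTo⁺₁)
open import Data.List.Relation.Unary.Any using (here; there)
open import Data.Nat as ℕ using (zero; suc; z≤n; s≤s; _<_; _<?_; _≤?_; _⊔_)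
import Data.Nat.Properties as ℕ
open import Data.Nat.Divisibility using (_∣_; _∣?_; divides; ∣⇒≤)
open import Data.Nat.GCD using (gcd; gcd[m,n]∣m; gcd[m,n]∣n)
open import Data.Nat.Tactic.RingSolver using (solve-∀)
open import Data.Product using (_×_; _,_)
open import Data.Rational as ℚ using (ℚ; 0ℚ; 1ℚ; _+_; _-_; toℚᵘ)
import Data.Rational.Properties as ℚ
import Data.Rational.Solver as ℚ-Solver
open import Data.Rational.Unnormalised as ℚᵘ using (mkℚᵘ; *≡*; *≤*)
import Data.Rational.Unnormalised.Properties as ℚᵘ
open import Function using (_∘_; id)
open import Level using (Level)
open import Relation.Binary.PropositionalEquality using (_≡_; refl; sym; trans; cong; cong₂; subst; subst₂; module ≡-Reasoning)
open import Relation.Nullary using (Dec; yes; no; does; ¬_; ¬?; _×-dec_; contradiction)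
open import Relation.Nullary.Decidable using (dec-true; dec-false)
open import Relation.Unary using (Pred; Decidable)
open import Relation.Unary.Properties using (∁?)

private variable
  i j ℓ : Level
  I : Set i
  J : Set j

module FiniteSum {c} {R : Set c} {_+_ _*_ : Op₂ R} {0# 1# : R}
                 (isCommutativeSemiring : IsCommutativeSemiring _≡_ _+_ _*_ 0# 1#) where
  open IsCommutativeSemiring isCommutativeSemiring
    using (+-identityˡ; +-identityʳ; +-assoc; +-isCommutativeSemigroup; *-comm; zeroʳ; distribˡ)
  open ≡-Reasoning

  private
    +-commutativeSemigroup : CommutativeSemigroup c c
    +-commutativeSemigroup = record { isCommutativeSemigroup = +-isCommutativeSemigroup }

  open import Algebra.Properties.CommutativeSemigroup +-commutativeSemigroup using (interchange)

  ∑ : List I → (I → R) → R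
  ∑ xs f = foldr _+_ 0# (map f xs)

  ∑-cong : ∀ (xs : List I) {f g} → (∀ x → f x ≡ g x) → ∑ xs f ≡ ∑ xs g
  ∑-cong []       f≡g = refl
  ∑-cong (x ∷ xs) f≡g = cong₂ _+_ (f≡g x) (∑-cong xs f≡g)

  ∑-++ : ∀ (xs ys : List I) f → ∑ (xs ++ ys) f ≡ ∑ xs f + ∑ ys f
  ∑-++ []       ys f = sym (+-identityˡ (∑ ys f))
  ∑-++ (x ∷ xs) ys f = trans (cong (_+_ (f x)) (∑-++ xs ys f)) (sym (+-assoc (f x) (∑ xs f) (∑ ys f)))

  ∑-upTo-suc : ∀ n f → ∑ (upTo (suc n)) f ≡ ∑ (upTo n) f + f n
  ∑-upTo-suc n f = begin
    ∑ (upTo (suc n)) f        ≡⟨ cong (λ xs → ∑ xs f) (sym (upTo-∷ʳ n)) ⟩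
    ∑ (upTo n ++ [ n ]) f     ≡⟨ ∑-++ (upTo n) [ n ] f ⟩
    ∑ (upTo n) f + (f n + 0#) ≡⟨ cong (_+_ (∑ (upTo n) f)) (+-identityʳ (f n)) ⟩
    ∑ (upTo n) f + f n        ∎

  ∑-map : ∀ (g : J → I) xs f → ∑ (map g xs) f ≡ ∑ xs (f ∘ g)
  ∑-map g []       f = refl
  ∑-map g (x ∷ xs) f = cong (_+_ (f (g x))) (∑-map g xs f)

  ∑-+ : ∀ (xs : List I) f g → ∑ xs (λ x → f x + g x) ≡ ∑ xs f + ∑ xs g
  ∑-+ []       f g = sym (+-identityˡ 0#)
  ∑-+ (x ∷ xs) f g = trans (cong (_+_ (f x + g x)) (∑-+ xs f g)) (interchange (f x) (g x) (∑ xs f) (∑ xs g))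

  ∑-*ˡ : ∀ (xs : List I) a f → a * ∑ xs f ≡ ∑ xs (λ x → a * f x)
  ∑-*ˡ []       a f = zeroʳ a
  ∑-*ˡ (x ∷ xs) a f = trans (distribˡ a (f x) (∑ xs f)) (cong (_+_ (a * f x)) (∑-*ˡ xs a f))

  ∑-*ʳ : ∀ (xs : List I) a f → ∑ xs f * a ≡ ∑ xs (λ x → f x * a)
  ∑-*ʳ xs a f = trans (*-comm (∑ xs f) a) (trans (∑-*ˡ xs a f) (∑-cong xs (λ x → *-comm a (f x))))

  ∑-swap : ∀ (xs : List I) (ys : List J) (f : I → J → R) →
           ∑ xs (λ x → ∑ ys (f x)) ≡ ∑ ys (λ y → ∑ xs (λ x → f x y))
  ∑-swap []       ys f = sym (∑-zero ys)
    where
    ∑-zero : ∀ (ys : List J) → ∑ ys (λ _ → 0#) ≡ 0#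
    ∑-zero []       = refl
    ∑-zero (y ∷ ys) = trans (+-identityˡ _) (∑-zero ys)
  ∑-swap (x ∷ xs) ys f = begin
    ∑ ys (f x) + ∑ xs (λ x → ∑ ys (f x))         ≡⟨ cong (_+_ (∑ ys (f x))) (∑-swap xs ys f) ⟩
    ∑ ys (f x) + ∑ ys (λ y → ∑ xs (λ x → f x y)) ≡⟨ sym (∑-+ ys (f x) _) ⟩
    ∑ ys (λ y → f x y + ∑ xs (λ x → f x y))      ∎

length-filter-∁ : ∀ {P : Pred I ℓ} (P? : Decidable P) xs →
                  length (filter P? xs) ℕ.+ length (filter (∁? P?) xs) ≡ length xs
length-filter-∁ P? []       = refl
length-filter-∁ P? (x ∷ xs) with does (P? x)
... | true  = cong suc (length-filter-∁ P? xs)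
... | false = trans (ℕ.+-suc _ _) (cong suc (length-filter-∁ P? xs))

[1‥_] : ℕ → List ℕ
[1‥ n ] = map suc (upTo n)

[1‥suc] : ∀ m → [1‥ suc m ] ≡ [1‥ m ] ++ [ suc m ]
[1‥suc] m = trans (cong (map suc) (sym (upTo-∷ʳ m))) (map-++ suc (upTo m) [ m ])

multiples : ℕ → ℕ → ℕ
multiples d m = length (filter (d ∣?_) [1‥ m ])

multiples-suc : ∀ d m → multiples d (suc m) ≡ multiples d m ℕ.+ length (filter (d ∣?_) [ suc m ])
multiples-suc d m = begin
  length (filter (d ∣?_) [1‥ suc m ])
    ≡⟨ cong (length ∘ filter (d ∣?_)) ([1‥suc] m) ⟩
  length (filter (d ∣?_) ([1‥ m ] ++ [ suc m ]))
    ≡⟨ cong length (filter-++ (d ∣?_) [1‥ m ] [ suc m ]) ⟩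
  length (filter (d ∣?_) [1‥ m ] ++ filter (d ∣?_) [ suc m ])
    ≡⟨ length-++ (filter (d ∣?_) [1‥ m ]) ⟩
  multiples d m ℕ.+ length (filter (d ∣?_) [ suc m ])
    ∎
  where open ≡-Reasoning

multiples-bound : ∀ d m → multiples d m ℕ.* d ℕ.≤ m
multiples-bound d zero    = z≤n
multiples-bound d (suc m) rewrite multiples-suc d m with d ∣? suc m
... | no _ = ℕ.≤-trans (ℕ.≤-reflexive (cong (ℕ._* d) (ℕ.+-identityʳ M)))
                       (ℕ.m≤n⇒m≤1+n (multiples-bound d m))
  where M = multiples d m
... | yes (divides q sm≡q*d) = begin
  (M ℕ.+ 1) ℕ.* d ≡⟨ cong (ℕ._* d) (ℕ.+-comm M 1) ⟩
  suc M ℕ.* d     ≤⟨ ℕ.*-monoˡ-≤ d M<q ⟩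
  q ℕ.* d         ≡⟨ sym sm≡q*d ⟩
  suc m           ∎
  where
  open ℕ.≤-Reasoning
  M = multiples d m
  M<q : M < q
  M<q = ℕ.*-cancelʳ-< d M q (ℕ.≤-trans (s≤s (multiples-bound d m)) (ℕ.≤-reflexive sm≡q*d))

fromℕ : ℕ → ℚ
fromℕ n = + n / 1

1/suc : ℕ → ℚ
1/suc n = + 1 / suc n

private
  toℚᵘ-/suc : ∀ a b → toℚᵘ (+ a / suc b) ℚᵘ.≃ mkℚᵘ (+ a) b
  toℚᵘ-/suc a b = ℚ.toℚᵘ-fromℚᵘ (mkℚᵘ (+ a) b)

/-cross-≡ : ∀ a b c d → a ℕ.* suc d ≡ c ℕ.* suc b → + a / suc b ≡ + c / suc d
/-cross-≡ a b c d eq = ℚ.toℚᵘ-injective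
  (ℚᵘ.≃-trans (toℚᵘ-/suc a b) (ℚᵘ.≃-trans (*≡* cross) (ℚᵘ.≃-sym (toℚᵘ-/suc c d))))
  where
  cross : + a ℤ.* + suc d ≡ + c ℤ.* + suc b
  cross = trans (sym (ℤ.pos-* a (suc d))) (trans (cong +_ eq) (ℤ.pos-* c (suc b)))

/-cross-≤ : ∀ a b c d → a ℕ.* suc d ℕ.≤ c ℕ.* suc b → + a / suc b ≤ + c / suc d
/-cross-≤ a b c d le = ℚ.toℚᵘ-cancel-≤
  (ℚᵘ.≤-respˡ-≃ (ℚᵘ.≃-sym (toℚᵘ-/suc a b))
  (ℚᵘ.≤-respʳ-≃ (ℚᵘ.≃-sym (toℚᵘ-/suc c d)) (*≤* cross)))
  where
  cross : + a ℤ.* + suc d ℤ.≤ + c ℤ.* + suc b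
  cross = subst₂ ℤ._≤_ (ℤ.pos-* a (suc d)) (ℤ.pos-* c (suc b)) (ℤ.+≤+ le)

/-+ : ∀ a b c d → + a / suc b + + c / suc d ≡ + (a ℕ.* suc d ℕ.+ c ℕ.* suc b) / (suc b ℕ.* suc d)
/-+ a b c d = ℚ.toℚᵘ-injective
  (ℚᵘ.≃-trans (ℚ.toℚᵘ-homo-+ (+ a / suc b) (+ c / suc d))
  (ℚᵘ.≃-trans (ℚᵘ.+-cong (toℚᵘ-/suc a b) (toℚᵘ-/suc c d))
  (ℚᵘ.≃-trans (ℚᵘ.≃-reflexive (cong (λ n → mkℚᵘ n (d ℕ.+ b ℕ.* suc d)) numerator))
  (ℚᵘ.≃-sym (toℚᵘ-/suc _ _)))))
  where
  numerator : + a ℤ.* + suc d ℤ.+ + c ℤ.* + suc b ≡ + (a ℕ.* suc d ℕ.+ c ℕ.* suc b)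
  numerator = sym (trans (ℤ.pos-+ (a ℕ.* suc d) (c ℕ.* suc b))
                         (cong₂ ℤ._+_ (ℤ.pos-* a (suc d)) (ℤ.pos-* c (suc b))))

/-* : ∀ a b c d → + a / suc b * (+ c / suc d) ≡ + (a ℕ.* c) / (suc b ℕ.* suc d)
/-* a b c d = ℚ.toℚᵘ-injective
  (ℚᵘ.≃-trans (ℚ.toℚᵘ-homo-* (+ a / suc b) (+ c / suc d))
  (ℚᵘ.≃-trans (ℚᵘ.*-cong (toℚᵘ-/suc a b) (toℚᵘ-/suc c d))
  (ℚᵘ.≃-trans (ℚᵘ.≃-reflexive (cong (λ n → mkℚᵘ n (d ℕ.+ b ℕ.* suc d)) (sym (ℤ.pos-* a c))))
  (ℚᵘ.≃-sym (toℚᵘ-/suc _ _)))))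

fromℕ-homo-+ : ∀ m n → fromℕ (m ℕ.+ n) ≡ fromℕ m + fromℕ n
fromℕ-homo-+ m n = sym (trans (/-+ m 0 n 0) (/-cross-≡ (m ℕ.* 1 ℕ.+ n ℕ.* 1) 0 (m ℕ.+ n) 0 (eq m n)))
  where
  eq : ∀ m n → (m ℕ.* 1 ℕ.+ n ℕ.* 1) ℕ.* 1 ≡ (m ℕ.+ n) ℕ.* 1
  eq = solve-∀

fromℕ-nonNeg : ∀ n → 0ℚ ≤ fromℕ n
fromℕ-nonNeg n = /-cross-≤ 0 0 n 0 z≤n

1/suc-nonNeg : ∀ n → 0ℚ ≤ 1/suc n
1/suc-nonNeg n = /-cross-≤ 0 0 1 n z≤n

fromℕ-*-1/suc : ∀ a b → fromℕ a * 1/suc b ≡ + a / suc b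
fromℕ-*-1/suc a b = trans (/-* a 0 1 b) (/-cross-≡ (a ℕ.* 1) (b ℕ.+ 0 ℕ.* suc b) a b (eq a b))
  where
  eq : ∀ a b → a ℕ.* 1 ℕ.* suc b ≡ a ℕ.* suc (b ℕ.+ 0 ℕ.* suc b)
  eq = solve-∀

fromℕ-suc-*-1/suc : ∀ n → fromℕ (suc n) * 1/suc n ≡ 1ℚ
fromℕ-suc-*-1/suc n = trans (fromℕ-*-1/suc (suc n) n) (/-cross-≡ (suc n) n 1 0 (ℕ.*-comm (suc n) 1))

1/suc-telescope : ∀ m → 1/suc (suc m) * 1/suc (suc m) + 1/suc (suc m) ≤ 1/suc m
1/suc-telescope m = begin
  1/suc (suc m) * 1/suc (suc m) + 1/suc (suc m) ≡⟨ cong (_+ 1/suc (suc m)) (/-* 1 (suc m) 1 (suc m)) ⟩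
  1/suc d²-1 + 1/suc (suc m)                     ≡⟨ /-+ 1 d²-1 1 (suc m) ⟩
  + (1 ℕ.* d ℕ.+ 1 ℕ.* d²) / (d² ℕ.* d)         ≤⟨ /-cross-≤ (1 ℕ.* d ℕ.+ 1 ℕ.* d²) d³-1 1 m cross ⟩
  1/suc m                                        ∎
  where
  open ℚ.≤-Reasoning
  d = suc (suc m)
  d²-1 = suc m ℕ.+ suc m ℕ.* d
  d² = suc d²-1
  d³-1 = suc m ℕ.+ d²-1 ℕ.* d
  identity : ∀ m → let d = suc (suc m) in
             (1 ℕ.* d ℕ.+ 1 ℕ.* (d ℕ.* d)) ℕ.* suc m ℕ.+ d ≡ 1 ℕ.* (d ℕ.* d ℕ.* d)
  identity = solve-∀
  cross : (1 ℕ.* d ℕ.+ 1 ℕ.* d²) ℕ.* suc m ℕ.≤ 1 ℕ.* suc d³-1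
  cross = ℕ.≤-trans (ℕ.m≤m+n _ d) (ℕ.≤-reflexive (identity m))

open FiniteSum (IsCommutativeRing.isCommutativeSemiring ℚ.+-*-isCommutativeRing)
open import Algebra.Properties.CommutativeSemigroup (CommutativeMonoid.commutativeSemigroup ℚ.*-1-commutativeMonoid)
  using (x∙yz≈y∙xz)

𝟙 : {P : Set ℓ} → Dec P → ℚ
𝟙 P? = if does P? then 1ℚ else 0ℚ

module _ {P : Set ℓ} (P? : Dec P) where

  𝟙-nonNeg : 0ℚ ≤ 𝟙 P?
  𝟙-nonNeg with does P?
  ... | true  = /-cross-≤ 0 0 1 0 z≤n
  ... | false = ℚ.≤-refl

  𝟙-yes : P → 𝟙 P? ≡ 1ℚ
  𝟙-yes x = cong (if_then 1ℚ else 0ℚ) (dec-true P? x)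

  𝟙-no : ¬ P → 𝟙 P? ≡ 0ℚ
  𝟙-no ¬x = cong (if_then 1ℚ else 0ℚ) (dec-false P? ¬x)

  𝟙-× : ∀ {Q : Set ℓ} (Q? : Dec Q) → 𝟙 (P? ×-dec Q?) ≡ 𝟙 P? * 𝟙 Q?
  𝟙-× Q? with does P? | does Q?
  ... | true  | true  = refl
  ... | true  | false = refl
  ... | false | true  = refl
  ... | false | false = refl

∑-𝟙 : ∀ {P : Pred I ℓ} (P? : Decidable P) xs → ∑ xs (𝟙 ∘ P?) ≡ fromℕ (length (filter P? xs))
∑-𝟙 P? []       = refl
∑-𝟙 P? (x ∷ xs) with does (P? x)
... | true  = trans (cong (_+_ 1ℚ) (∑-𝟙 P? xs)) (sym (fromℕ-homo-+ 1 (length (filter P? xs))))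
... | false = trans (ℚ.+-identityˡ _) (∑-𝟙 P? xs)

∑-𝟙-× : ∀ {P : Set ℓ} {Q : Pred I ℓ} (P? : Dec P) (Q? : Decidable Q) xs →
        ∑ xs (λ x → 𝟙 (P? ×-dec Q? x)) ≡ 𝟙 P? * fromℕ (length (filter Q? xs))
∑-𝟙-× P? Q? xs = begin
  ∑ xs (λ x → 𝟙 (P? ×-dec Q? x))  ≡⟨ ∑-cong xs (λ x → 𝟙-× P? (Q? x)) ⟩
  ∑ xs (λ x → 𝟙 P? * 𝟙 (Q? x))    ≡⟨ ∑-*ˡ xs (𝟙 P?) (𝟙 ∘ Q?) ⟨
  𝟙 P? * ∑ xs (𝟙 ∘ Q?)            ≡⟨ cong (𝟙 P? *_) (∑-𝟙 Q? xs) ⟩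
  𝟙 P? * fromℕ (length (filter Q? xs)) ∎
  where open ≡-Reasoning

p≤p+q : ∀ {p q} → 0ℚ ≤ q → p ≤ p + q
p≤p+q {p} 0≤q = ℚ.≤-trans (ℚ.≤-reflexive (sym (ℚ.+-identityʳ p))) (ℚ.+-monoʳ-≤ p 0≤q)

*-monoˡ-≤-0≤ : ∀ {r p q} → 0ℚ ≤ r → p ≤ q → r * p ≤ r * q
*-monoˡ-≤-0≤ {r} 0≤r = ℚ.*-monoˡ-≤-nonNeg r {{ℚ.nonNegative 0≤r}}

*-monoʳ-≤-0≤ : ∀ {r p q} → 0ℚ ≤ r → p ≤ q → p * r ≤ q * r
*-monoʳ-≤-0≤ {r} 0≤r = ℚ.*-monoʳ-≤-nonNeg r {{ℚ.nonNegative 0≤r}}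

∑-mono-≤ : ∀ (xs : List I) {f g} → All (λ x → f x ≤ g x) xs → ∑ xs f ≤ ∑ xs g
∑-mono-≤ []       []              = ℚ.≤-refl
∑-mono-≤ (x ∷ xs) (fx≤gx ∷ fs≤gs) = ℚ.+-mono-≤ fx≤gx (∑-mono-≤ xs fs≤gs)

∑-nonNeg : ∀ (xs : List I) {f} → (∀ x → 0ℚ ≤ f x) → 0ℚ ≤ ∑ xs f
∑-nonNeg []       _   = ℚ.≤-refl
∑-nonNeg (x ∷ xs) 0≤f = ℚ.+-mono-≤ (0≤f x) (∑-nonNeg xs 0≤f)

summand-≤-∑ : ∀ {xs : List I} {f x} → (∀ y → 0ℚ ≤ f y) → x ∈ xs → f x ≤ ∑ xs f
summand-≤-∑ {xs = _ ∷ xs} 0≤f (here refl) = p≤p+q (∑-nonNeg xs 0≤f)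
summand-≤-∑ {xs = y ∷ xs} {f} 0≤f (there x∈xs) = ℚ.≤-trans (summand-≤-∑ 0≤f x∈xs)
  (ℚ.≤-trans (p≤p+q (0≤f y)) (ℚ.≤-reflexive (ℚ.+-comm (∑ xs f) (f y))))

1-/suc-filter : ∀ {P : Pred ℕ ℓ} (P? : Decidable P) k →
  1ℚ - + length (filter P? [1‥ suc k ]) / suc k ≡ fromℕ (length (filter (∁? P?) [1‥ suc k ])) * 1/suc k
1-/suc-filter P? k = begin
  1ℚ - + a / suc k                  ≡⟨ cong₂ _-_ (sym (fromℕ-suc-*-1/suc k)) (sym (fromℕ-*-1/suc a k)) ⟩
  fromℕ (suc k) * r - fromℕ a * r   ≡⟨ cong (λ n → fromℕ n * r - fromℕ a * r) a+b≡n ⟨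
  fromℕ (a ℕ.+ b) * r - fromℕ a * r ≡⟨ cong (λ x → x * r - fromℕ a * r) (fromℕ-homo-+ a b) ⟩
  (fromℕ a + fromℕ b) * r - fromℕ a * r
    ≡⟨ solve 3 (λ a b r → (a :+ b) :* r :- a :* r := b :* r) refl (fromℕ a) (fromℕ b) r ⟩
  fromℕ b * r                       ∎
  where
  open ≡-Reasoning
  open ℚ-Solver.+-*-Solver
  a = length (filter P? [1‥ suc k ])
  b = length (filter (∁? P?) [1‥ suc k ])
  r = 1/suc k
  a+b≡n : a ℕ.+ b ≡ suc k
  a+b≡n = trans (length-filter-∁ P? [1‥ suc k ]) (trans (length-map suc (upTo (suc k))) (length-upTo (suc k)))

largeDivisor? : ∀ T n d → Dec (T < d × d ∣ n)
largeDivisor? T n d = T <? d ×-dec d ∣? n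

large-gcd-≤-∑ : ∀ T {k X} u → suc k ℕ.≤ X →
  𝟙 (¬? (gcd u (suc k) ≤? T)) ≤ ∑ (upTo X) (λ j → 𝟙 (largeDivisor? T (suc k) (suc j) ×-dec suc j ∣? u))
large-gcd-≤-∑ T {k} {X} u n≤X = divisor-≤-∑ (gcd u (suc k)) (gcd u (suc k) ≤? T)
  (gcd[m,n]∣n u (suc k)) (gcd[m,n]∣m u (suc k)) (ℕ.≤-trans (∣⇒≤ (gcd[m,n]∣n u (suc k))) n≤X)
  where
  largeCommonDivisor? : ∀ j → Dec ((T < suc j × suc j ∣ suc k) × suc j ∣ u)
  largeCommonDivisor? j = largeDivisor? T (suc k) (suc j) ×-dec suc j ∣? u

  divisor-≤-∑ : ∀ d (d≤?T : Dec (d ℕ.≤ T)) → d ∣ suc k → d ∣ u → d ℕ.≤ X →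
                𝟙 (¬? d≤?T) ≤ ∑ (upTo X) (𝟙 ∘ largeCommonDivisor?)
  divisor-≤-∑ _       (yes _)  _   _   _   = ∑-nonNeg (upTo X) (𝟙-nonNeg ∘ largeCommonDivisor?)
  divisor-≤-∑ zero    (no 0≰T) _   _   _   = contradiction z≤n 0≰T
  divisor-≤-∑ (suc j) (no d≰T) d∣n d∣u d≤X = ℚ.≤-trans
    (ℚ.≤-reflexive (sym (𝟙-yes (largeCommonDivisor? j) ((ℕ.≰⇒> d≰T , d∣n) , d∣u))))
    (summand-≤-∑ (𝟙-nonNeg ∘ largeCommonDivisor?) (∈-upTo⁺ d≤X))

a*d≤n⇒a*1/n≤1/d : ∀ a j k → a ℕ.* suc j ℕ.≤ suc k → fromℕ a * 1/suc k ≤ 1/suc j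
a*d≤n⇒a*1/n≤1/d a j k le = subst (_≤ 1/suc j) (sym (fromℕ-*-1/suc a k))
  (/-cross-≤ a k 1 j (ℕ.≤-trans le (ℕ.≤-reflexive (sym (ℕ.*-identityˡ (suc k))))))

a*d≤m⇒a*1/d≤m*1/d² : ∀ a j m → a ℕ.* suc j ℕ.≤ m → fromℕ a * 1/suc j ≤ fromℕ m * (1/suc j * 1/suc j)
a*d≤m⇒a*1/d≤m*1/d² a j m le = begin
  fromℕ a * 1/suc j                 ≡⟨ fromℕ-*-1/suc a j ⟩
  + a / suc j                       ≤⟨ /-cross-≤ a j m d²-1 cross ⟩
  + m / suc d²-1                    ≡⟨ fromℕ-*-1/suc m d²-1 ⟨
  fromℕ m * 1/suc d²-1              ≡⟨ cong (fromℕ m *_) (/-* 1 j 1 j) ⟨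
  fromℕ m * (1/suc j * 1/suc j)     ∎
  where
  open ℚ.≤-Reasoning
  d²-1 = j ℕ.+ j ℕ.* suc j
  cross : a ℕ.* suc d²-1 ℕ.≤ m ℕ.* suc j
  cross = ℕ.≤-trans (ℕ.≤-reflexive (sym (ℕ.*-assoc a (suc j) (suc j)))) (ℕ.*-monoˡ-≤ (suc j) le)

term-≤-∑-large-divisors : ∀ T {k X} → suc k ℕ.≤ X →
  term T k ≤ ∑ (upTo X) (λ j → 𝟙 (largeDivisor? T (suc k) (suc j)) * 1/suc j)
term-≤-∑-large-divisors T {k} {X} n≤X = begin
  term T k
    ≡⟨ 1-/suc-filter (λ u → gcd u n ≤? T) k ⟩
  fromℕ (length (filter large? [1‥ n ])) * r
    ≡⟨ cong (_* r) (∑-𝟙 large? [1‥ n ]) ⟨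
  ∑ [1‥ n ] (𝟙 ∘ large?) * r
    ≤⟨ *-monoʳ-≤-0≤ (1/suc-nonNeg k) (∑-mono-≤ [1‥ n ] (All.tabulate (λ {u} _ → large-gcd-≤-∑ T u n≤X))) ⟩
  ∑ [1‥ n ] (λ u → ∑ (upTo X) (λ j → 𝟙 (L? j ×-dec suc j ∣? u))) * r
    ≡⟨ cong (_* r) (∑-swap [1‥ n ] (upTo X) _) ⟩
  ∑ (upTo X) (λ j → ∑ [1‥ n ] (λ u → 𝟙 (L? j ×-dec suc j ∣? u))) * r
    ≡⟨ cong (_* r) (∑-cong (upTo X) (λ j → ∑-𝟙-× (L? j) (suc j ∣?_) [1‥ n ])) ⟩
  ∑ (upTo X) (λ j → 𝟙 (L? j) * fromℕ (multiples (suc j) n)) * r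
    ≡⟨ ∑-*ʳ (upTo X) r _ ⟩
  ∑ (upTo X) (λ j → 𝟙 (L? j) * fromℕ (multiples (suc j) n) * r)
    ≤⟨ ∑-mono-≤ (upTo X) (All.tabulate (λ {j} _ → bound j)) ⟩
  ∑ (upTo X) (λ j → 𝟙 (L? j) * 1/suc j)
    ∎
  where
  open ℚ.≤-Reasoning
  n = suc k
  r = 1/suc k
  large? = ∁? (λ u → gcd u n ≤? T)
  L? = λ j → largeDivisor? T n (suc j)
  bound : ∀ j → 𝟙 (L? j) * fromℕ (multiples (suc j) n) * r ≤ 𝟙 (L? j) * 1/suc j
  bound j = ℚ.≤-trans (ℚ.≤-reflexive (ℚ.*-assoc (𝟙 (L? j)) _ r))
    (*-monoˡ-≤-0≤ (𝟙-nonNeg (L? j)) (a*d≤n⇒a*1/n≤1/d (multiples (suc j) n) j k (multiples-bound (suc j) n)))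

tailSummand : ℕ → ℕ → ℚ
tailSummand T j = 𝟙 (T <? suc j) * (1/suc j * 1/suc j)

S≤X*∑-tailSummand : ∀ T X → S T X ≤ fromℕ X * ∑ (upTo X) (tailSummand T)
S≤X*∑-tailSummand T X = begin
  ∑ (upTo X) (term T)
    ≤⟨ ∑-mono-≤ (upTo X) (applyUpTo⁺₁ id X (term-≤-∑-large-divisors T)) ⟩
  ∑ (upTo X) (λ k → ∑ (upTo X) (λ j → 𝟙 (largeDivisor? T (suc k) (suc j)) * 1/suc j))
    ≡⟨ ∑-map suc (upTo X) (λ n → ∑ (upTo X) (λ j → 𝟙 (largeDivisor? T n (suc j)) * 1/suc j)) ⟨
  ∑ [1‥ X ] (λ n → ∑ (upTo X) (λ j → 𝟙 (largeDivisor? T n (suc j)) * 1/suc j))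
    ≡⟨ ∑-swap [1‥ X ] (upTo X) _ ⟩
  ∑ (upTo X) (λ j → ∑ [1‥ X ] (λ n → 𝟙 (largeDivisor? T n (suc j)) * 1/suc j))
    ≡⟨ ∑-cong (upTo X) count ⟩
  ∑ (upTo X) (λ j → 𝟙 (T <? suc j) * fromℕ (multiples (suc j) X) * 1/suc j)
    ≤⟨ ∑-mono-≤ (upTo X) (All.tabulate (λ {j} _ → bound j)) ⟩
  ∑ (upTo X) (λ j → fromℕ X * tailSummand T j)
    ≡⟨ ∑-*ˡ (upTo X) (fromℕ X) (tailSummand T) ⟨
  fromℕ X * ∑ (upTo X) (tailSummand T) ∎
  where
  open ℚ.≤-Reasoning
  count : ∀ j → ∑ [1‥ X ] (λ n → 𝟙 (largeDivisor? T n (suc j)) * 1/suc j)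
              ≡ 𝟙 (T <? suc j) * fromℕ (multiples (suc j) X) * 1/suc j
  count j = trans (sym (∑-*ʳ [1‥ X ] (1/suc j) _)) (cong (_* 1/suc j) (∑-𝟙-× (T <? suc j) (suc j ∣?_) [1‥ X ]))
  bound : ∀ j → 𝟙 (T <? suc j) * fromℕ (multiples (suc j) X) * 1/suc j ≤ fromℕ X * tailSummand T j
  bound j = begin
    𝟙 (T <? suc j) * fromℕ M * r           ≡⟨ ℚ.*-assoc (𝟙 (T <? suc j)) (fromℕ M) r ⟩
    𝟙 (T <? suc j) * (fromℕ M * r)
      ≤⟨ *-monoˡ-≤-0≤ (𝟙-nonNeg (T <? suc j)) (a*d≤m⇒a*1/d≤m*1/d² M j X (multiples-bound (suc j) X)) ⟩
    𝟙 (T <? suc j) * (fromℕ X * (r * r))   ≡⟨ x∙yz≈y∙xz (𝟙 (T <? suc j)) (fromℕ X) (r * r) ⟩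
    fromℕ X * tailSummand T j                 ∎
    where
    M = multiples (suc j) X
    r = 1/suc j

∑-tailSummand-telescope : ∀ t X → ∑ (upTo (suc X)) (tailSummand (suc t)) + 1/suc (t ⊔ X) ≤ 1/suc t
∑-tailSummand-telescope t zero    = ℚ.≤-reflexive (trans (ℚ.+-identityˡ _) (cong 1/suc (ℕ.⊔-identityʳ t)))
∑-tailSummand-telescope t (suc X) with t ℕ.≤? X
... | yes t≤X = begin
  ∑ (upTo (suc (suc X))) f + 1/suc (t ⊔ suc X)
    ≡⟨ cong₂ _+_ (∑-upTo-suc (suc X) f) (cong 1/suc (ℕ.m≤n⇒m⊔n≡n (ℕ.m≤n⇒m≤1+n t≤X))) ⟩
  (Σ + f (suc X)) + r   ≡⟨ cong (λ x → (Σ + x) + r) f[1+X]≡r² ⟩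
  (Σ + r * r) + r       ≡⟨ ℚ.+-assoc Σ (r * r) r ⟩
  Σ + (r * r + r)       ≤⟨ ℚ.+-monoʳ-≤ Σ (1/suc-telescope X) ⟩
  Σ + 1/suc X           ≡⟨ cong (λ m → Σ + 1/suc m) (ℕ.m≤n⇒m⊔n≡n t≤X) ⟨
  Σ + 1/suc (t ⊔ X)     ≤⟨ ∑-tailSummand-telescope t X ⟩
  1/suc t               ∎
  where
  open ℚ.≤-Reasoning
  f = tailSummand (suc t)
  Σ = ∑ (upTo (suc X)) f
  r = 1/suc (suc X)
  f[1+X]≡r² : f (suc X) ≡ r * r
  f[1+X]≡r² = trans (cong (_* (r * r)) (𝟙-yes (suc t <? suc (suc X)) (s≤s (s≤s t≤X)))) (ℚ.*-identityˡ (r * r))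
... | no t≰X = begin
  ∑ (upTo (suc (suc X))) f + 1/suc (t ⊔ suc X)
    ≡⟨ cong₂ _+_ (∑-upTo-suc (suc X) f) (cong 1/suc (ℕ.m≥n⇒m⊔n≡m X<t)) ⟩
  (Σ + f (suc X)) + 1/suc t ≡⟨ cong (λ x → (Σ + x) + 1/suc t) f[1+X]≡0 ⟩
  (Σ + 0ℚ) + 1/suc t        ≡⟨ cong (_+ 1/suc t) (ℚ.+-identityʳ Σ) ⟩
  Σ + 1/suc t               ≡⟨ cong (λ m → Σ + 1/suc m) (ℕ.m≥n⇒m⊔n≡m (ℕ.<⇒≤ X<t)) ⟨
  Σ + 1/suc (t ⊔ X)         ≤⟨ ∑-tailSummand-telescope t X ⟩
  1/suc t                   ∎
  where
  open ℚ.≤-Reasoning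
  f = tailSummand (suc t)
  Σ = ∑ (upTo (suc X)) f
  r = 1/suc (suc X)
  X<t : X < t
  X<t = ℕ.≰⇒> t≰X
  f[1+X]≡0 : f (suc X) ≡ 0ℚ
  f[1+X]≡0 = trans (cong (_* (r * r)) (𝟙-no (suc t <? suc (suc X)) (λ { (s≤s (s≤s t≤X)) → t≰X t≤X })))
                   (ℚ.*-zeroˡ (r * r))

T*∑-tailSummand≤1 : ∀ t X → fromℕ (suc t) * ∑ (upTo X) (tailSummand (suc t)) ≤ 1ℚ
T*∑-tailSummand≤1 t X = begin
  fromℕ (suc t) * ∑ (upTo X) (tailSummand (suc t)) ≤⟨ *-monoˡ-≤-0≤ (fromℕ-nonNeg (suc t)) (∑≤ X) ⟩
  fromℕ (suc t) * 1/suc t                          ≡⟨ fromℕ-suc-*-1/suc t ⟩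
  1ℚ                                               ∎
  where
  open ℚ.≤-Reasoning
  ∑≤ : ∀ X → ∑ (upTo X) (tailSummand (suc t)) ≤ 1/suc t
  ∑≤ zero    = 1/suc-nonNeg t
  ∑≤ (suc X) = ℚ.≤-trans (p≤p+q (1/suc-nonNeg (t ⊔ X))) (∑-tailSummand-telescope t X)

T*S≤X : ∀ t X → fromℕ (suc t) * S (suc t) X ≤ fromℕ X
T*S≤X t X = begin
  fromℕ T * S T X                                 ≤⟨ *-monoˡ-≤-0≤ (fromℕ-nonNeg T) (S≤X*∑-tailSummand T X) ⟩
  fromℕ T * (fromℕ X * ∑ (upTo X) (tailSummand T)) ≡⟨ x∙yz≈y∙xz (fromℕ T) (fromℕ X) _ ⟩
  fromℕ X * (fromℕ T * ∑ (upTo X) (tailSummand T)) ≤⟨ *-monoˡ-≤-0≤ (fromℕ-nonNeg X) (T*∑-tailSummand≤1 t X) ⟩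
  fromℕ X * 1ℚ                                     ≡⟨ ℚ.*-identityʳ (fromℕ X) ⟩
  fromℕ X                                          ∎
  where
  open ℚ.≤-Reasoning
  T = suc t

lemma2p1 : ∃ λ (C : ℕ) → ∀ (X T : ℕ) → 1 ≤ℕ X → 2 ≤ℕ T →
    ((+ T) / 1) * S T X ≤ (+ (C *ℕ X)) / 1
lemma2p1 = 1 , λ where
  X zero    _ ()
  X (suc t) _ _  → subst (λ m → fromℕ (suc t) * S (suc t) X ≤ fromℕ m) (sym (ℕ.*-identityˡ X)) (T*S≤X t X)
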